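{- Let $G$ be a $2$-edge-connected graph, let $R(G)$ be the set of edges $f\in E(G)$ such that $G-f$ is not $2$-edge-connected, and let $H=G-R(G)$ (the graph on $V(G)$ with edge set $E(G)\setminus R(G)$). If $H$ has $q$ connected components, then $|R(G)|\le 2q-2$.
   Context: A graph is $2$-edge-connected if it is connected and remains connected after deleting any single edge. For $f\in E(G)$, $G-f$ is the graph on $V(G)$ with edge set $E(G)\setminus\{f\}$. Graphs are finite and simple. -}

module Defs where

open import Data.Nat using (ℕ; _<_; _+_; _*_)
open import Data.Fin using (Fin; toℕ)
open import Data.Product using (_×_; _,_; Σ; ∃)
open import Data.List using (List; length)
open import Data.List.Membership.Propositional using (_∈_)
open import Data.List.Relation.Unary.All using (All)
open import Data.List.Relation.Unary.Unique.Propositional using (Unique)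
open import Relation.Binary.PropositionalEquality using (_≡_)
open import Relation.Nullary using (¬_)
open import Function.Bundles using (_⇔_)
open import Level using (0ℓ; suc)

-- An edge {i,j} is written as the ordered pair (i , j) with toℕ i < toℕ j.
Edge : ℕ → Set
Edge n = Fin n × Fin n

-- A finite simple graph on vertex set Fin n: a duplicate-free list of edges,
-- each stored as (i , j) with i < j (so no loops and no parallel edges).
record Graph (n : ℕ) : Set where
  constructor graph
  field
    edges   : List (Edge n)
    ordered : All (λ e → toℕ (Data.Product.proj₁ e) < toℕ (Data.Product.proj₂ e)) edges
    simple  : Unique edges
open Graph public

-- A spanning subgraph on Fin n is described by a predicate on edges
-- (which edges of the ambient graph are present).
EdgeSet : ℕ → Set₁
EdgeSet n = Edge n → Set

E : ∀ {n} → Graph n → EdgeSet n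
E G e = e ∈ edges G

_minus_ : ∀ {n} → EdgeSet n → Edge n → EdgeSet n
(S minus f) e = S e × ¬ (e ≡ f)

_minusSet_ : ∀ {n} → EdgeSet n → EdgeSet n → EdgeSet n
(S minusSet R) e = S e × ¬ R e

data Reach {n : ℕ} (S : EdgeSet n) : Fin n → Fin n → Set where
  here  : ∀ {u} → Reach S u u
  fwd   : ∀ {u v w} → S (u , v) → Reach S v w → Reach S u w
  bwd   : ∀ {u v w} → S (v , u) → Reach S v w → Reach S u w

Connected : ∀ {n} → EdgeSet n → Set
Connected {n} S = (0 < n) × (∀ u v → Reach S u v)

TwoEdgeConnected : ∀ {n} → EdgeSet n → Set
TwoEdgeConnected S = Connected S × (∀ f → S f → Connected (S minus f))

Rset : ∀ {n} → Graph n → EdgeSet n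
Rset G f = E G f × ¬ TwoEdgeConnected (E G minus f)

-- S has exactly q connected components: there is a surjective labelling of the
-- vertices by Fin q whose fibres are exactly the reachability classes.
HasComponents : ∀ {n} → EdgeSet n → ℕ → Set
HasComponents {n} S q =
  Σ (Fin n → Fin q) λ c →
    (∀ (k : Fin q) → ∃ λ v → c v ≡ k) ×
    (∀ u v → (c u ≡ c v) ⇔ Reach S u v)

-- |X| ≤ m for an edge set X: every duplicate-free list of edges of X has length ≤ m.
-- (Stated additively.)
CardPlusLe : ∀ {n} → EdgeSet n → ℕ → ℕ → Set
CardPlusLe S a m = ∀ (L : List (Edge _)) → Unique L → All S L → length L + a Data.Nat.≤ m

module Submission where

-- Greedily choose a spanning forest F₁ of G/H (G with the components of H
-- contracted), then a second one F₂ among the edges not in F₁; each has at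
-- most q - 1 edges, so it suffices to show R ⊆ F₁ ∪ F₂.
--
-- If f ∈ R lay in neither forest, its endpoints would be joined by walks in
-- H ∪ F₁ and in H ∪ F₂ avoiding f.  For another edge g, either some walk
-- avoids g, and f can be bypassed in the connected graph G - g; or g lies on
-- both walks, hence in H, so G - g is 2-edge-connected.  Either way G - f - g
-- is connected, so G - f is 2-edge-connected, contradicting f ∈ R.  As
-- membership in H is a negated statement, this runs under a double negation,
-- which commutes with quantifying over the finitely many edges of G.

open import Defs
open import Data.Nat using (ℕ; _*_; zero; suc; _+_; _≤_; _<_; z≤n; s≤s)
open import Data.Nat.Properties using (≤-refl; +-mono-≤; +-suc; +-comm; +-identityʳ; module ≤-Reasoning)
open import Data.Fin as Fin using (Fin; punchOut; fromℕ<)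
open import Data.Fin.Properties using (punchOut-injective)
open import Data.Product using (_×_; _,_; proj₁; proj₂)
open import Data.Product.Properties using (≡-dec)
open import Data.Sum using (_⊎_; inj₁; inj₂)
open import Data.Empty using (⊥-elim)
open import Data.List using (List; []; _∷_; length; filter; _++_)
open import Data.List.Properties using (length-++)
open import Data.List.Membership.Propositional using (_∈_; _∉_)
open import Data.List.Membership.Propositional.Properties
  using (∈-filter⁺; ∈-filter⁻; ∈-++⁺ˡ; ∈-++⁺ʳ; ∈-++⁻; ∈-∃++)
import Data.List.Membership.DecPropositional as DecMembership
open import Data.List.Relation.Binary.Subset.Propositional using (_⊆_)
open import Data.List.Relation.Unary.Any using (here; there)
import Data.List.Relation.Unary.All as All
open import Data.List.Relation.Unary.AllPairs using (_∷_)
open import Data.List.Relation.Unary.Unique.Propositional using (Unique)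
open import Relation.Binary.PropositionalEquality using (_≡_; refl; sym; trans; cong; subst)
open import Relation.Nullary using (¬_; yes; no; ¬?)
open import Relation.Nullary.Negation using (DoubleNegation; ¬¬-map)
open import Relation.Binary using (DecidableEquality)
open import Function.Bundles using (Equivalence)

_≟E_ : ∀ {n} → DecidableEquality (Edge n)
_≟E_ = ≡-dec Fin._≟_ Fin._≟_

module EdgeMembership {n : ℕ} = DecMembership (_≟E_ {n})

_⊆E_ : ∀ {n} → EdgeSet n → EdgeSet n → Set
S ⊆E T = ∀ {e} → S e → T e

_∪L_ : ∀ {n} → EdgeSet n → List (Edge n) → EdgeSet n
(S ∪L L) e = S e ⊎ e ∈ L

minus-comm : ∀ {n} {S : EdgeSet n} {f g} → ((S minus f) minus g) ⊆E ((S minus g) minus f)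
minus-comm ((s , e≢f) , e≢g) = (s , e≢g) , e≢f

reach-mono : ∀ {n} {S T : EdgeSet n} → S ⊆E T → ∀ {x y} → Reach S x y → Reach T x y
reach-mono S⊆T here      = here
reach-mono S⊆T (fwd s w) = fwd (S⊆T s) (reach-mono S⊆T w)
reach-mono S⊆T (bwd s w) = bwd (S⊆T s) (reach-mono S⊆T w)

reach-trans : ∀ {n} {S : EdgeSet n} {x y z} → Reach S x y → Reach S y z → Reach S x z
reach-trans here      w′ = w′
reach-trans (fwd s w) w′ = fwd s (reach-trans w w′)
reach-trans (bwd s w) w′ = bwd s (reach-trans w w′)

reach-sym : ∀ {n} {S : EdgeSet n} {x y} → Reach S x y → Reach S y x
reach-sym here      = here
reach-sym (fwd s w) = reach-trans (reach-sym w) (bwd s here)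
reach-sym (bwd s w) = reach-trans (reach-sym w) (fwd s here)

reach-replace : ∀ {n} {S T : EdgeSet n} → (∀ a b → S (a , b) → Reach T a b) →
                ∀ {x y} → Reach S x y → Reach T x y
reach-replace step here      = here
reach-replace step (fwd s w) = reach-trans (step _ _ s) (reach-replace step w)
reach-replace step (bwd s w) = reach-trans (reach-sym (step _ _ s)) (reach-replace step w)

avoid : ∀ {n} {S : EdgeSet n} (g : Edge n) {x y} → Reach S x y → Reach (S minus g) x y ⊎ S g
avoid g here = inj₁ here
avoid g (fwd {u} {v} s w) with (u , v) ≟E g | avoid g w
... | yes refl | _        = inj₂ s
... | no uv≢g  | inj₁ w′  = inj₁ (fwd (s , uv≢g) w′)
... | no _     | inj₂ s′  = inj₂ s′
avoid g (bwd {u} {v} s w) with (v , u) ≟E g | avoid g w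
... | yes refl | _        = inj₂ s
... | no vu≢g  | inj₁ w′  = inj₁ (bwd (s , vu≢g) w′)
... | no _     | inj₂ s′  = inj₂ s′

connected-mono : ∀ {n} {S T : EdgeSet n} → S ⊆E T → Connected S → Connected T
connected-mono S⊆T (n>0 , reach) = n>0 , λ x y → reach-mono S⊆T (reach x y)

connected-bypass : ∀ {n} {S : EdgeSet n} {u v} →
                   Connected S → Reach (S minus (u , v)) u v → Connected (S minus (u , v))
connected-bypass {S = S} {u} {v} (n>0 , reach) w = n>0 , λ x y → reach-replace step (reach x y)
  where
  step : ∀ a b → S (a , b) → Reach (S minus (u , v)) a b
  step a b s with (a , b) ≟E (u , v)
  ... | yes refl = w
  ... | no ab≢uv = fwd (s , ab≢uv) here

¬¬-∀∈ : ∀ {A : Set} {P : A → Set} (xs : List A) →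
        (∀ x → x ∈ xs → DoubleNegation (P x)) → DoubleNegation (∀ x → x ∈ xs → P x)
¬¬-∀∈ []       h k = k (λ _ ())
¬¬-∀∈ (x ∷ xs) h k =
  h x (here refl) λ px →
  ¬¬-∀∈ xs (λ y y∈xs → h y (there y∈xs)) λ pxs →
  k λ { y (here refl) → px ; y (there y∈xs) → pxs y y∈xs }

redirect : ∀ {k} (a b : Fin k) → Fin k → Fin k
redirect a b x with x Fin.≟ b
... | yes _ = a
... | no  _ = x

-- For a ≢ b, redirected labels miss b, so b can be punched out.
redirect-avoids : ∀ {k} {a b : Fin k} → ¬ a ≡ b → ∀ x → ¬ b ≡ redirect a b x
redirect-avoids {a = a} {b} a≢b x with x Fin.≟ b
... | yes _   = λ b≡a → a≢b (sym b≡a)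
... | no  x≢b = λ b≡x → x≢b (sym b≡x)

identify : ∀ {k} (a b : Fin (suc k)) → ¬ a ≡ b → Fin (suc k) → Fin k
identify a b a≢b x = punchOut (redirect-avoids a≢b x)

data Identified {k} (a b x y : Fin k) : Set where
  equal : x ≡ y → Identified a b x y
  ba    : x ≡ b → y ≡ a → Identified a b x y
  ab    : x ≡ a → y ≡ b → Identified a b x y

redirect-identified : ∀ {k} (a b x y : Fin k) → redirect a b x ≡ redirect a b y → Identified a b x y
redirect-identified a b x y eq with x Fin.≟ b | y Fin.≟ b
... | yes x≡b | yes y≡b = equal (trans x≡b (sym y≡b))
... | yes x≡b | no  _   = ba x≡b (sym eq)
... | no  _   | yes y≡b = ab eq y≡b
... | no  _   | no  _   = equal eq

identify-identified : ∀ {k} (a b : Fin (suc k)) (a≢b : ¬ a ≡ b) x y →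
                      identify a b a≢b x ≡ identify a b a≢b y → Identified a b x y
identify-identified a b a≢b x y eq =
  redirect-identified a b x y (punchOut-injective (redirect-avoids a≢b x) (redirect-avoids a≢b y) eq)

-- Scan the edges; keep an edge iff its endpoints carry different labels,
-- and then identify those two labels.  Each kept edge uses up one label.
greedy : ∀ {n} k → (Fin n → Fin k) → List (Edge n) → List (Edge n)
greedy k       c []             = []
greedy zero    c ((u , v) ∷ es) with c u
... | ()
greedy (suc k) c ((u , v) ∷ es) with c u Fin.≟ c v
... | yes _   = greedy (suc k) c es
... | no cu≢cv = (u , v) ∷ greedy k (λ x → identify (c u) (c v) cu≢cv (c x)) es

greedy-length : ∀ {n} (v₀ : Fin n) k (c : Fin n → Fin k) es → length (greedy k c es) < k
greedy-length v₀ zero    c es with c v₀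
... | ()
greedy-length v₀ (suc k) c [] = s≤s z≤n
greedy-length v₀ (suc k) c ((u , v) ∷ es) with c u Fin.≟ c v
... | yes _    = greedy-length v₀ (suc k) c es
... | no cu≢cv = s≤s (greedy-length v₀ k _ es)

greedy-⊆ : ∀ {n} k (c : Fin n → Fin k) es → greedy k c es ⊆ es
greedy-⊆ k       c []             ()
greedy-⊆ zero    c ((u , v) ∷ es) p with c u
... | ()
greedy-⊆ (suc k) c ((u , v) ∷ es) p with c u Fin.≟ c v
greedy-⊆ (suc k) c ((u , v) ∷ es) p         | yes _ = there (greedy-⊆ (suc k) c es p)
greedy-⊆ (suc k) c ((u , v) ∷ es) (here eq) | no _  = here eq
greedy-⊆ (suc k) c ((u , v) ∷ es) (there p) | no _  = there (greedy-⊆ k _ es p)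

Joins : ∀ {n k} → EdgeSet n → (Fin n → Fin k) → Set
Joins {n} X c = ∀ (x y : Fin n) → c x ≡ c y → Reach X x y

joins-identify : ∀ {n k} {X : EdgeSet n} (c : Fin n → Fin (suc k)) {u v} (cu≢cv : ¬ c u ≡ c v) →
                 Joins X c →
                 Joins (λ e → X e ⊎ e ≡ (u , v)) (λ x → identify (c u) (c v) cu≢cv (c x))
joins-identify c {u} {v} cu≢cv joins x y eq with identify-identified (c u) (c v) cu≢cv (c x) (c y) eq
... | equal cx≡cy = reach-mono inj₁ (joins x y cx≡cy)
... | ba cx≡cv cy≡cu =
  reach-trans (reach-mono inj₁ (joins x v cx≡cv))
    (reach-trans (bwd (inj₂ refl) here) (reach-mono inj₁ (joins u y (sym cy≡cu))))
... | ab cx≡cu cy≡cv =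
  reach-trans (reach-mono inj₁ (joins x u cx≡cu))
    (reach-trans (fwd (inj₂ refl) here) (reach-mono inj₁ (joins v y (sym cy≡cv))))

greedy-spans : ∀ {n} k (c : Fin n → Fin k) es (X : EdgeSet n) → Joins X c →
               ∀ {e} → e ∈ es → Reach (X ∪L greedy k c es) (proj₁ e) (proj₂ e)
greedy-spans k       c []             X joins ()
greedy-spans zero    c ((u , v) ∷ es) X joins p with c u
... | ()
greedy-spans (suc k) c ((u , v) ∷ es) X joins p with c u Fin.≟ c v
greedy-spans (suc k) c ((u , v) ∷ es) X joins (here refl) | yes cu≡cv =
  reach-mono inj₁ (joins u v cu≡cv)
greedy-spans (suc k) c ((u , v) ∷ es) X joins (there p)   | yes _ =
  greedy-spans (suc k) c es X joins p
greedy-spans (suc k) c ((u , v) ∷ es) X joins (here refl) | no _ =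
  fwd (inj₂ (here refl)) here
greedy-spans (suc k) c ((u , v) ∷ es) X joins (there p)   | no cu≢cv =
  reach-mono regroup (greedy-spans k _ es _ (joins-identify c cu≢cv joins) p)
  where
  regroup : ∀ {e} → ((λ e → X e ⊎ e ≡ (u , v)) ∪L greedy k _ es) e →
            (X ∪L ((u , v) ∷ greedy k _ es)) e
  regroup (inj₁ (inj₁ x))  = inj₁ x
  regroup (inj₁ (inj₂ eq)) = inj₂ (here eq)
  regroup (inj₂ p)         = inj₂ (there p)

∈-remove : ∀ {A : Set} {x y : A} ys zs → y ∈ ys ++ x ∷ zs → ¬ x ≡ y → y ∈ ys ++ zs
∈-remove ys zs y∈ x≢y with ∈-++⁻ ys y∈
... | inj₁ y∈ys         = ∈-++⁺ˡ y∈ys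
... | inj₂ (here y≡x)   = ⊥-elim (x≢y (sym y≡x))
... | inj₂ (there y∈zs) = ∈-++⁺ʳ ys y∈zs

unique-⊆-length : ∀ {A : Set} (L M : List A) → Unique L → L ⊆ M → length L ≤ length M
unique-⊆-length []      M unique         L⊆M = z≤n
unique-⊆-length (x ∷ L) M (x∉L ∷ unique) L⊆M with ∈-∃++ (L⊆M (here refl))
... | ys , zs , refl =
  subst (suc (length L) ≤_) (sym length-M)
    (s≤s (unique-⊆-length L (ys ++ zs) unique
      (λ y∈L → ∈-remove ys zs (L⊆M (there y∈L)) (All.lookup x∉L y∈L))))
  where
  length-M : length (ys ++ x ∷ zs) ≡ suc (length (ys ++ zs))
  length-M = trans (length-++ ys) (trans (+-suc (length ys) (length zs)) (cong suc (sym (length-++ ys))))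

module Robust {n : ℕ} (G : Graph n) (tec : TwoEdgeConnected (E G)) where

  H : EdgeSet n
  H = E G minusSet Rset G

  -- If g ∈ H then G - g is 2-edge-connected (classically), so G - f - g is connected.
  connected-via-H : ∀ {f g} → H g → E G f → ¬ f ≡ g →
                    DoubleNegation (Connected ((E G minus f) minus g))
  connected-via-H (Eg , g∉R) Ef f≢g k =
    g∉R (Eg , λ tec-g → k (connected-mono (minus-comm {S = E G}) (proj₂ tec-g _ (Ef , f≢g))))

  robust-edge : ∀ {u v} (S₁ S₂ : EdgeSet n) →
                E G (u , v) → S₁ ⊆E (E G minus (u , v)) → S₂ ⊆E (E G minus (u , v)) →
                (∀ {g} → S₁ g → S₂ g → H g) → Reach S₁ u v → Reach S₂ u v →
                DoubleNegation (TwoEdgeConnected (E G minus (u , v)))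
  robust-edge {u} {v} S₁ S₂ Ef S₁⊆ S₂⊆ shared⊆H w₁ w₂ =
    ¬¬-map (λ all → proj₂ tec f Ef , λ g gf → all g (proj₁ gf) gf) (¬¬-∀∈ (edges G) connected′)
    where
    f : Edge n
    f = u , v

    -- a walk in S ⊆ G - f avoiding g bypasses f in the connected graph G - g
    via-walk : ∀ {S g} → E G g → S ⊆E (E G minus f) → Reach (S minus g) u v →
               Connected ((E G minus f) minus g)
    via-walk Eg S⊆ w = connected-mono (minus-comm {S = E G})
      (connected-bypass (proj₂ tec _ Eg)
        (reach-mono (λ (s , e≢g) → (proj₁ (S⊆ s) , e≢g) , proj₂ (S⊆ s)) w))

    connected : ∀ g → (E G minus f) g → DoubleNegation (Connected ((E G minus f) minus g))
    connected g (Eg , g≢f) with avoid g w₁ | avoid g w₂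
    ... | inj₁ w | _      = λ k → k (via-walk Eg S₁⊆ w)
    ... | inj₂ _ | inj₁ w = λ k → k (via-walk Eg S₂⊆ w)
    ... | inj₂ s₁ | inj₂ s₂ = connected-via-H (shared⊆H s₁ s₂) Ef (λ f≡g → g≢f (sym f≡g))

    -- the same, stated for every edge of G so that ¬¬-∀∈ applies
    connected′ : ∀ g → g ∈ edges G → DoubleNegation ((E G minus f) g → Connected ((E G minus f) minus g))
    connected′ g Eg with g ≟E f
    ... | yes g≡f = λ k → k (λ (_ , g≢f) → ⊥-elim (g≢f g≡f))
    ... | no  g≢f = ¬¬-map (λ conn _ → conn) (connected g (Eg , g≢f))

module Forests {n : ℕ} (G : Graph n) (q : ℕ) (tec : TwoEdgeConnected (E G))
  (c : Fin n → Fin q) (joins : Joins (E G minusSet Rset G) c) where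

  open Robust G tec
  open EdgeMembership using (_∈?_)

  F₁ : List (Edge n)
  F₁ = greedy q c (edges G)

  rest : List (Edge n)
  rest = filter (λ e → ¬? (e ∈? F₁)) (edges G)

  F₂ : List (Edge n)
  F₂ = greedy q c rest

  F₁⊆G : ∀ {e} → e ∈ F₁ → E G e
  F₁⊆G = greedy-⊆ q c (edges G)

  F₂-disjoint : ∀ {e} → e ∈ F₂ → E G e × e ∉ F₁
  F₂-disjoint p = ∈-filter⁻ (λ e → ¬? (e ∈? F₁)) {xs = edges G} (greedy-⊆ q c rest p)

  H∪F⊆G-f : ∀ {F f} → (∀ {e} → e ∈ F → E G e) → f ∉ F → Rset G f → (H ∪L F) ⊆E (E G minus f)
  H∪F⊆G-f F⊆G f∉F Rf (inj₁ (Ee , e∉R)) = Ee , λ { refl → e∉R Rf }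
  H∪F⊆G-f F⊆G f∉F Rf (inj₂ e∈F)        = F⊆G e∈F , λ { refl → f∉F e∈F }

  shared⊆H : ∀ {g} → (H ∪L F₁) g → (H ∪L F₂) g → H g
  shared⊆H (inj₁ h) _        = h
  shared⊆H (inj₂ _) (inj₁ h) = h
  shared⊆H (inj₂ p₁) (inj₂ p₂) = ⊥-elim (proj₂ (F₂-disjoint p₂) p₁)

  R⊆F₁++F₂ : ∀ {f} → Rset G f → f ∈ F₁ ++ F₂
  R⊆F₁++F₂ {f} Rf with f ∈? F₁ | f ∈? F₂
  ... | yes f∈F₁ | _        = ∈-++⁺ˡ f∈F₁
  ... | no  _    | yes f∈F₂ = ∈-++⁺ʳ F₁ f∈F₂
  ... | no  f∉F₁ | no  f∉F₂ = ⊥-elim (robust-edge (H ∪L F₁) (H ∪L F₂) (proj₁ Rf)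
          (H∪F⊆G-f F₁⊆G f∉F₁ Rf) (H∪F⊆G-f (λ p → proj₁ (F₂-disjoint p)) f∉F₂ Rf) shared⊆H
          (greedy-spans q c (edges G) H joins (proj₁ Rf))
          (greedy-spans q c rest H joins (∈-filter⁺ (λ e → ¬? (e ∈? F₁)) (proj₁ Rf) f∉F₁))
          (proj₂ Rf))

lemma2p4 : ∀ {n} (G : Graph n) (q : ℕ) →
    TwoEdgeConnected (E G) →
    HasComponents (E G minusSet Rset G) q →
    CardPlusLe (Rset G) 2 (2 * q)
lemma2p4 {n} G q tec (c , _ , fibres) L unique L⊆R = begin
  length L + 2                              ≤⟨ +-mono-≤ L≤F₁++F₂ (≤-refl {2}) ⟩
  length (F₁ ++ F₂) + 2                     ≡⟨ cong (_+ 2) (length-++ F₁) ⟩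
  length F₁ + length F₂ + 2                 ≡⟨ +-comm (length F₁ + length F₂) 2 ⟩
  suc (suc (length F₁ + length F₂))         ≡⟨ cong suc (sym (+-suc (length F₁) (length F₂))) ⟩
  suc (length F₁) + suc (length F₂)         ≤⟨ +-mono-≤ (greedy-length v₀ q c (edges G)) (greedy-length v₀ q c rest) ⟩
  q + q                                     ≡⟨ cong (q +_) (sym (+-identityʳ q)) ⟩
  2 * q                                     ∎
  where
  open Forests G q tec c (λ x y → Equivalence.to (fibres x y))
  open ≤-Reasoning
  v₀ : Fin n
  v₀ = fromℕ< (proj₁ (proj₁ tec))
  L≤F₁++F₂ : length L ≤ length (F₁ ++ F₂)
  L≤F₁++F₂ = unique-⊆-length L (F₁ ++ F₂) unique (λ f∈L → R⊆F₁++F₂ (All.lookup L⊆R f∈L))
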